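{- Let $P$ be a process of the role-annotated $\pi$-calculus described in the context. If $P$ is well typed, i.e. there exist environments $\Delta$ and $\Gamma$ such that $\Delta;\Gamma\vdash_{\emptyset} P$ is derivable, then $P$ is not an authorization error.
   Context: Fix infinite sets of labels $l\in\mathcal{L}$, roles $r,s,q\in\mathcal{R}$ and channels $a,b,c\in\mathcal{N}$. A qualified role is $\rho::=r^{\checkmark}\mid r^{\times}$ ($r$ authorized, resp. unauthorized); $\sigma$ also ranges over qualified roles. Processes: $P,Q::=0\mid P\mid Q\mid(\nu a)P\mid \alpha.P$, with prefixes $\alpha::= a_\rho!l\langle b\rangle\mid a_\rho?l(b)\mid a_\rho!l\langle\sigma\rangle\mid a_\rho?l(r)$ (send/receive a channel name, send a qualified role, receive an authorization for role $r$, each on channel $a$, under qualified role $\rho$, with message label $l$); $?l(b)$ binds $b$. Structural congruence $\equiv$ is the standard one of the $\pi$-calculus. A prefix is unauthorized if it has one of the forms $a_{r^\times}?l(b)$, $a_{r^\times}!l\langle b\rangle$, $a_{r^\times}?l(s)$, $a_{r^\times}!l\langle s^\checkmark\rangle$, or $a_\sigma!l\langle s^\times\rangle$. A process $P$ is an authorization error if $P\equiv(\nu\tilde a)(\alpha.Q\mid R)$ for some names $\tilde a$, unauthorized prefix $\alpha$, and processes $Q,R$. Types: $B::=\mathrm{end}\mid B\mid B\mid \Diamond B\mid p\,l(M).B$, $T::=l(B)$, $M::=B\mid T\mid r$, $p::=!r\mid ?r\mid \tau_{r\to r'}$ (output by $r$, input by $r$, synchronized exchange from $r$ to $r'$). $\Delta$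 maps channels to behavioral types $B$ (linear usage), $\Gamma$ maps channels to shared types $T$. The typing uses the conversation-type relations of subtyping $<:$ (allowing behaviour prescribed now to be used where it is expected to happen sometime, $\Diamond$), splitting $B=B_1\circ B_2$ (distributing a protocol into participant slices, lifted pointwise to environments, with $\Delta,a{:}B=\Delta_1,a{:}B\circ\Delta_2$ when $\Delta=\Delta_1\circ\Delta_2$), the predicate $\mathtt{matched}(B)$ (no unmatched input or output in $B$), and $\Delta_{\mathrm{end}}$ (environment with only $\mathrm{end}$ types). Judgments $\Delta;\Gamma\vdash_\Sigma P$ have $\Sigma\subseteq\mathcal{N}\times\mathcal{R}$ (pairs (channel, role) occurring unauthorized); write $\mathrm{ch}(\Sigma)$ for its first projection, and let $\mathrm{ua}(a,r^\times)=\{(a,r)\}$, $\mathrm{ua}(a,r^\checkmark)=\emptyset$. Rules (with $\rho$ being $r^\checkmark$ or $r^\times$): - $\Delta_{\mathrm{end}};\Gamma\vdash_\emptyset 0$. - From $\Delta;\Gamma,a{:}l(B)\vdash_\Sigma P$ infer $\Delta;\Gamma\vdash_\Sigma(\nu a)P$. - From $\Delta,a{:}B;\Gamma\vdash_\Sigma P$, $\mathtt{matched}(B)$, $a\notin\mathrm{ch}(\Sigma)$ infer $\Delta;\Gamma\vdash_\Sigma(\nu a)P$. - From $\Delta_1;\Gamma\vdash_\Sigma P$ and $\Delta_2;\Gamma\vdash_\Xi Q$ infer $\Delta_1\circ\Delta_2;\Gamma\vdash_{\Sigma\cup\Xi}P\mid Q$. - From $\Delta\circ a{:}B;\Gamma\vdash_{\Sigma\cup\{(a,s)\}}P$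 and $?r\,l(s).B<:B'$ infer $\Delta\circ a{:}B';\Gamma\vdash_{\Sigma\cup \mathrm{ua}(a,\rho)} a_\rho?l(s).P$. - From $\Delta\circ a{:}B;\Gamma\vdash_\Sigma P$ and $!r\,l(s).B<:B'$ infer $\Delta\circ a{:}B';\Gamma\vdash_{\Sigma\cup\mathrm{ua}(a,\rho)\cup\mathrm{ua}(a,\sigma)}a_\rho!l\langle\sigma\rangle.P$, where $\sigma\in\{s^\checkmark,s^\times\}$. - From $\Delta\circ a{:}B,b{:}B';\Gamma\vdash_\Sigma P$, $?r\,l(B').B<:B''$, $b\notin\mathrm{ch}(\Sigma)$ infer $\Delta\circ a{:}B'';\Gamma\vdash_{\Sigma\cup\mathrm{ua}(a,\rho)}a_\rho?l(b).P$. - From $\Delta\circ a{:}B;\Gamma\vdash_\Sigma P$ and $!r\,l(B').B<:B''$ infer $\Delta\circ a{:}B''\circ b{:}B';\Gamma\vdash_{\Sigma\cup\mathrm{ua}(a,\rho)}a_\rho!l\langle b\rangle.P$. - From $\Delta\circ a{:}B';\Gamma,b{:}T\vdash_\Sigma P$, $?r\,l(T).B'<:B$, $b\notin\mathrm{ch}(\Sigma)$ infer $\Delta\circ a{:}B;\Gamma\vdash_{\Sigma\cup\mathrm{ua}(a,\rho)}a_\rho?l(b).P$. - From $\Delta\circ a{:}B';\Gamma,b{:}T\vdash_\Sigma P$, $!r\,l(T).B'<:B$ infer $\Delta\circ a{:}B;\Gamma,b{:}T\vdash_{\Sigma\cup\mathrm{ua}(a,\rho)}a_\rho!l\langle b\rangle.P$.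 - From $\Delta,b{:}B;\Gamma,a{:}l(B)\vdash_\Sigma P$, $b\notin\mathrm{ch}(\Sigma)$ infer $\Delta;\Gamma,a{:}l(B)\vdash_\Sigma a_{r^\checkmark}?l(b).P$. - From $\Delta;\Gamma,a{:}l(B)\vdash_\Sigma P$ infer $\Delta\circ b{:}B;\Gamma,a{:}l(B)\vdash_\Sigma a_{r^\checkmark}!l\langle b\rangle.P$. -}

module Defs where

open import Data.Nat using (ℕ; _≡ᵇ_)
open import Data.Bool using (Bool; true; false; _∨_; _∧_; if_then_else_)
open import Data.Maybe using (Maybe; just; nothing)
open import Data.Product using (_×_; _,_; ∃-syntax)
open import Data.Sum using (_⊎_)
open import Data.List using (List; []; _∷_)
open import Relation.Binary.PropositionalEquality using (_≡_; _≢_)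
open import Relation.Nullary using (¬_)

-- Names: labels, roles and channels (infinite sets, taken to be ℕ)

Label : Set
Label = ℕ

Role : Set
Role = ℕ

Chan : Set
Chan = ℕ

-- Qualified roles  ρ ::= r✓ | r×
data QRole : Set where
  auth   : Role → QRole
  unauth : Role → QRole

roleOf : QRole → Role
roleOf (auth r)   = r
roleOf (unauth r) = r

data Prefix : Set where
  sendCh   : Chan → QRole → Label → Chan  → Prefix
  recvCh   : Chan → QRole → Label → Chan  → Prefix  -- a_ρ?l(b)   (binds b)
  sendRole : Chan → QRole → Label → QRole → Prefix
  recvRole : Chan → QRole → Label → Role  → Prefix

infixr 8 _·_
infixl 6 _∣_

data Proc : Set where
  𝟎   : Proc
  _∣_ : Proc → Proc → Proc
  ν   : Chan → Proc → Proc
  _·_ : Prefix → Proc → Proc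

data FreeIn (a : Chan) : Proc → Set where
  fr-parˡ   : ∀ {P Q} → FreeIn a P → FreeIn a (P ∣ Q)
  fr-parʳ   : ∀ {P Q} → FreeIn a Q → FreeIn a (P ∣ Q)
  fr-res    : ∀ {c P} → a ≢ c → FreeIn a P → FreeIn a (ν c P)
  fr-subjSC : ∀ {ρ l b P} → FreeIn a (sendCh a ρ l b · P)
  fr-subjRC : ∀ {ρ l b P} → FreeIn a (recvCh a ρ l b · P)
  fr-subjSR : ∀ {ρ l σ P} → FreeIn a (sendRole a ρ l σ · P)
  fr-subjRR : ∀ {ρ l r P} → FreeIn a (recvRole a ρ l r · P)
  fr-objSC  : ∀ {c ρ l P} → FreeIn a (sendCh c ρ l a · P)
  fr-contSC : ∀ {c ρ l b P} → FreeIn a P → FreeIn a (sendCh c ρ l b · P)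
  fr-contRC : ∀ {c ρ l b P} → a ≢ b → FreeIn a P → FreeIn a (recvCh c ρ l b · P)
  fr-contSR : ∀ {c ρ l σ P} → FreeIn a P → FreeIn a (sendRole c ρ l σ · P)
  fr-contRR : ∀ {c ρ l r P} → FreeIn a P → FreeIn a (recvRole c ρ l r · P)

_∉fn_ : Chan → Proc → Set
a ∉fn P = ¬ FreeIn a P

-- transposition (a b) of channel names, applied to all names
swapN : Chan → Chan → Chan → Chan
swapN a b x = if x ≡ᵇ a then b else (if x ≡ᵇ b then a else x)

swapPre : Chan → Chan → Prefix → Prefix
swapPre a b (sendCh c ρ l d)   = sendCh (swapN a b c) ρ l (swapN a b d)
swapPre a b (recvCh c ρ l d)   = recvCh (swapN a b c) ρ l (swapN a b d)
swapPre a b (sendRole c ρ l σ) = sendRole (swapN a b c) ρ l σ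
swapPre a b (recvRole c ρ l r) = recvRole (swapN a b c) ρ l r

swap : Chan → Chan → Proc → Proc
swap a b 𝟎       = 𝟎
swap a b (P ∣ Q) = swap a b P ∣ swap a b Q
swap a b (ν c P) = ν (swapN a b c) (swap a b P)
swap a b (α · P) = swapPre a b α · swap a b P

infix 4 _≡ₛ_
data _≡ₛ_ : Proc → Proc → Set where
  s-refl    : ∀ {P} → P ≡ₛ P
  s-sym     : ∀ {P Q} → P ≡ₛ Q → Q ≡ₛ P
  s-trans   : ∀ {P Q R} → P ≡ₛ Q → Q ≡ₛ R → P ≡ₛ R
  s-par     : ∀ {P P' Q Q'} → P ≡ₛ P' → Q ≡ₛ Q' → P ∣ Q ≡ₛ P' ∣ Q'
  s-res     : ∀ {a P P'} → P ≡ₛ P' → ν a P ≡ₛ ν a P'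
  s-pre     : ∀ {α P P'} → P ≡ₛ P' → α · P ≡ₛ α · P'
  s-alphaν  : ∀ {a b P} → b ∉fn P → ν a P ≡ₛ ν b (swap a b P)
  s-alphaIn : ∀ {c ρ l a b P} → b ∉fn P →
              recvCh c ρ l a · P ≡ₛ recvCh c ρ l b · swap a b P
  s-parNil  : ∀ {P} → P ∣ 𝟎 ≡ₛ P
  s-parComm : ∀ {P Q} → P ∣ Q ≡ₛ Q ∣ P
  s-parAssoc : ∀ {P Q R} → (P ∣ Q) ∣ R ≡ₛ P ∣ (Q ∣ R)
  s-resNil  : ∀ {a} → ν a 𝟎 ≡ₛ 𝟎
  s-resComm : ∀ {a b P} → ν a (ν b P) ≡ₛ ν b (ν a P)
  s-extr    : ∀ {a P Q} → a ∉fn Q → ν a P ∣ Q ≡ₛ ν a (P ∣ Q)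

data Unauthorized : Prefix → Set where
  ua-recvCh   : ∀ a r l b → Unauthorized (recvCh a (unauth r) l b)
  ua-sendCh   : ∀ a r l b → Unauthorized (sendCh a (unauth r) l b)
  ua-recvRole : ∀ a r l s → Unauthorized (recvRole a (unauth r) l s)
  ua-sendAuth : ∀ a r l s → Unauthorized (sendRole a (unauth r) l (auth s))
  ua-sendUn   : ∀ a σ l s → Unauthorized (sendRole a σ l (unauth s))

νs : List Chan → Proc → Proc
νs []       P = P
νs (a ∷ as) P = ν a (νs as P)

AuthError : Proc → Set
AuthError P = ∃[ as ] ∃[ α ] ∃[ Q ] ∃[ R ]
  (Unauthorized α × P ≡ₛ νs as ((α · Q) ∣ R))

-- Types
--   B ::= end | B | B | ◇B | p l(M).B ;  T ::= l(B) ;  M ::= B | T | r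
--   p ::= !r | ?r | τ_{r→r'}

data Act : Set where
  out : Role → Act
  inp : Role → Act
  tau : Role → Role → Act

infixl 5 _∥_

data BType : Set
data Msg : Set

data BType where
  end : BType
  _∥_ : BType → BType → BType
  ◇   : BType → BType
  act : Act → Label → Msg → BType → BType

-- shared types T = l(B) are represented as a pair (l , B)
SType : Set
SType = Label × BType

data Msg where
  mB : BType → Msg
  mT : SType → Msg
  mR : Role → Msg

-- Subtyping B <: B' (behaviour prescribed now may be used where it is
-- expected to happen sometime, ◇), closed under the type constructors.
infix 4 _<:_
data _<:_ : BType → BType → Set where
  sub-refl  : ∀ {B} → B <: B
  sub-trans : ∀ {B₁ B₂ B₃} → B₁ <: B₂ → B₂ <: B₃ → B₁ <: B₃
  sub-◇     : ∀ {B} → B <: ◇ B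
  sub-par   : ∀ {B₁ B₂ B₁' B₂'} → B₁ <: B₁' → B₂ <: B₂' → B₁ ∥ B₂ <: B₁' ∥ B₂'
  sub-◇cong : ∀ {B B'} → B <: B' → ◇ B <: ◇ B'
  sub-act   : ∀ {p l M B B'} → B <: B' → act p l M B <: act p l M B'

-- Splitting  B = B₁ ∘ B₂   (written Split B B₁ B₂)
data Split : BType → BType → BType → Set where
  sp-end  : ∀ {B} → Split B B end
  sp-comm : ∀ {B B₁ B₂} → Split B B₁ B₂ → Split B B₂ B₁
  sp-par  : ∀ {B₁ B₂} → Split (B₁ ∥ B₂) B₁ B₂
  sp-parˡ : ∀ {B B₁ B₂ C} → Split B B₁ B₂ → Split (B ∥ C) (B₁ ∥ C) B₂
  sp-◇    : ∀ {B B₁ B₂} → Split B B₁ B₂ → Split (◇ B) (◇ B₁) (◇ B₂)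
  sp-act  : ∀ {p l M B B₁ B₂} → Split B B₁ B₂ →
            Split (act p l M B) (act p l M B₁) B₂
  sp-tau  : ∀ {r r' l M B B₁ B₂} → Split B B₁ B₂ →
            Split (act (tau r r') l M B) (act (out r) l M B₁) (act (inp r') l M B₂)

data Matched : BType → Set where
  m-end : Matched end
  m-par : ∀ {B₁ B₂} → Matched B₁ → Matched B₂ → Matched (B₁ ∥ B₂)
  m-◇   : ∀ {B} → Matched B → Matched (◇ B)
  m-tau : ∀ {r r' l M B} → Matched B → Matched (act (tau r r') l M B)

-- Environments (finite partial maps, represented as functions)

LEnv : Set
LEnv = Chan → Maybe BType

SEnv : Set
SEnv = Chan → Maybe SType

-- Δ, a:B   /  Γ, a:T  (used together with the side condition that a ∉ dom)
extend : {A : Set} → (Chan → Maybe A) → Chan → A → (Chan → Maybe A)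
extend Δ a B x = if x ≡ᵇ a then just B else Δ x

sing : Chan → BType → LEnv
sing a B x = if x ≡ᵇ a then just B else nothing

EndEnv : LEnv → Set
EndEnv Δ = ∀ x → Δ x ≡ nothing ⊎ Δ x ≡ just end

data MSplit : Maybe BType → Maybe BType → Maybe BType → Set where
  ms-none : MSplit nothing nothing nothing
  ms-left : ∀ {B} → MSplit (just B) (just B) nothing
  ms-right : ∀ {B} → MSplit (just B) nothing (just B)
  ms-both : ∀ {B B₁ B₂} → Split B B₁ B₂ → MSplit (just B) (just B₁) (just B₂)

EnvSplit : LEnv → LEnv → LEnv → Set
EnvSplit Δ Δ₁ Δ₂ = ∀ x → MSplit (Δ x) (Δ₁ x) (Δ₂ x)

-- Sets Σ ⊆ 𝒩 × ℛ of unauthorized (channel, role) pairs,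
-- as Boolean-valued characteristic functions, compared extensionally.

USet : Set
USet = Chan → Role → Bool

∅ : USet
∅ _ _ = false

_∪_ : USet → USet → USet
(Σ ∪ Ξ) a r = Σ a r ∨ Ξ a r

single : Chan → Role → USet
single a r b s = (b ≡ᵇ a) ∧ (s ≡ᵇ r)

ua : Chan → QRole → USet
ua a (auth r)   = ∅
ua a (unauth r) = single a r

infix 4 _≈_
_≈_ : USet → USet → Set
Σ ≈ Ξ = ∀ a r → Σ a r ≡ Ξ a r

_∉ch_ : Chan → USet → Set
a ∉ch Σ = ∀ r → Σ a r ≡ false

-- Typing  Δ ; Γ ⊢_Σ P
-- Every rule concludes at an arbitrary Σ' equal (as a set) to the one
-- prescribed by the paper, and premises are likewise taken up to set
-- equality.

infix 3 _⨾_⊢[_]_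
data _⨾_⊢[_]_ : LEnv → SEnv → USet → Proc → Set where

  t-nil : ∀ {Δ Γ Σ} → EndEnv Δ → Σ ≈ ∅ → Δ ⨾ Γ ⊢[ Σ ] 𝟎

  t-resS : ∀ {Δ Γ Σ a l B P} →
    Γ a ≡ nothing →
    Δ ⨾ extend Γ a (l , B) ⊢[ Σ ] P →
    Δ ⨾ Γ ⊢[ Σ ] ν a P

  t-resL : ∀ {Δ Γ Σ a B P} →
    Δ a ≡ nothing →
    extend Δ a B ⨾ Γ ⊢[ Σ ] P → Matched B → a ∉ch Σ →
    Δ ⨾ Γ ⊢[ Σ ] ν a P

  t-par : ∀ {Δ Δ₁ Δ₂ Γ Σ Ξ Σ' P Q} →
    EnvSplit Δ Δ₁ Δ₂ →
    Δ₁ ⨾ Γ ⊢[ Σ ] P → Δ₂ ⨾ Γ ⊢[ Ξ ] Q →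
    Σ' ≈ Σ ∪ Ξ →
    Δ ⨾ Γ ⊢[ Σ' ] P ∣ Q

  t-recvRole : ∀ {Δ Δ₁ Δ₂ Γ Σ Σ₁ Σ' a ρ l s B B' P} →
    EnvSplit Δ₁ Δ (sing a B) →
    Σ₁ ≈ Σ ∪ single a s →
    Δ₁ ⨾ Γ ⊢[ Σ₁ ] P →
    act (inp (roleOf ρ)) l (mR s) B <: B' →
    EnvSplit Δ₂ Δ (sing a B') →
    Σ' ≈ Σ ∪ ua a ρ →
    Δ₂ ⨾ Γ ⊢[ Σ' ] recvRole a ρ l s · P

  t-sendRole : ∀ {Δ Δ₁ Δ₂ Γ Σ Σ' a ρ l σ B B' P} →
    EnvSplit Δ₁ Δ (sing a B) →
    Δ₁ ⨾ Γ ⊢[ Σ ] P →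
    act (out (roleOf ρ)) l (mR (roleOf σ)) B <: B' →
    EnvSplit Δ₂ Δ (sing a B') →
    Σ' ≈ (Σ ∪ ua a ρ) ∪ ua a σ →
    Δ₂ ⨾ Γ ⊢[ Σ' ] sendRole a ρ l σ · P

  t-recvChL : ∀ {Δ Δ₁ Δ₂ Γ Σ Σ' a ρ l b B B' B'' P} →
    EnvSplit Δ₁ Δ (sing a B) →
    Δ₁ b ≡ nothing →
    extend Δ₁ b B' ⨾ Γ ⊢[ Σ ] P →
    act (inp (roleOf ρ)) l (mB B') B <: B'' →
    b ∉ch Σ →
    EnvSplit Δ₂ Δ (sing a B'') →
    Σ' ≈ Σ ∪ ua a ρ →
    Δ₂ ⨾ Γ ⊢[ Σ' ] recvCh a ρ l b · P

  t-sendChL : ∀ {Δ Δ₁ Δ₂ X Γ Σ Σ' a ρ l b B B' B'' P} →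
    EnvSplit Δ₁ Δ (sing a B) →
    Δ₁ ⨾ Γ ⊢[ Σ ] P →
    act (out (roleOf ρ)) l (mB B') B <: B'' →
    EnvSplit X Δ (sing a B'') →
    EnvSplit Δ₂ X (sing b B') →
    Σ' ≈ Σ ∪ ua a ρ →
    Δ₂ ⨾ Γ ⊢[ Σ' ] sendCh a ρ l b · P

  t-recvChS : ∀ {Δ Δ₁ Δ₂ Γ Σ Σ' a ρ l b T B B' P} →
    EnvSplit Δ₁ Δ (sing a B') →
    Γ b ≡ nothing →
    Δ₁ ⨾ extend Γ b T ⊢[ Σ ] P →
    act (inp (roleOf ρ)) l (mT T) B' <: B →
    b ∉ch Σ →
    EnvSplit Δ₂ Δ (sing a B) →
    Σ' ≈ Σ ∪ ua a ρ →
    Δ₂ ⨾ Γ ⊢[ Σ' ] recvCh a ρ l b · P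

  -- a_ρ!l⟨b⟩.P, b shared (Γ = Γ₀, b:T in premise and conclusion)
  t-sendChS : ∀ {Δ Δ₁ Δ₂ Γ Σ Σ' a ρ l b T B B' P} →
    EnvSplit Δ₁ Δ (sing a B') →
    Γ b ≡ just T →
    Δ₁ ⨾ Γ ⊢[ Σ ] P →
    act (out (roleOf ρ)) l (mT T) B' <: B →
    EnvSplit Δ₂ Δ (sing a B) →
    Σ' ≈ Σ ∪ ua a ρ →
    Δ₂ ⨾ Γ ⊢[ Σ' ] sendCh a ρ l b · P

  t-accept : ∀ {Δ Γ Σ a r l b B P} →
    Γ a ≡ just (l , B) →
    Δ b ≡ nothing →
    extend Δ b B ⨾ Γ ⊢[ Σ ] P →
    b ∉ch Σ →
    Δ ⨾ Γ ⊢[ Σ ] recvCh a (auth r) l b · P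

  t-request : ∀ {Δ Δ' Γ Σ a r l b B P} →
    Γ a ≡ just (l , B) →
    Δ ⨾ Γ ⊢[ Σ ] P →
    EnvSplit Δ' Δ (sing b B) →
    Δ' ⨾ Γ ⊢[ Σ ] sendCh a (auth r) l b · P

module Submission where

-- An authorization error is a process structurally congruent to one that
-- exposes an unauthorized prefix, i.e. has such a prefix at top level
-- (under parallel composition and restriction only, not under another
-- prefix).  The proof rests on two facts:
--
--   * Exposure of an unauthorized prefix is invariant under structural
--     congruence.  Every axiom of ≡ₛ only rearranges the parallel /
--     restriction skeleton or renames channels, and unauthorization of a
--     prefix depends on its qualified roles only, never on its channels.
--
--   * A typing derivation Δ ; Γ ⊢[ Σ ] P records every exposed
--     unauthorized prefix of P in Σ: the typing rule for such a prefix
--     adds the pair (subject channel, unauthorized role) to Σ, and the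
--     rules for parallel composition and restriction keep Σ.
--
-- Hence a process typed with Σ = ∅ exposes no unauthorized prefix, and
-- neither does anything structurally congruent to it.

open import Defs
open import Data.Bool using (T)
open import Data.Bool.Properties using (T-∨; T-∧)
open import Data.Nat.Properties using (≡⇒≡ᵇ)
open import Data.Product using (∃-syntax; _×_; _,_)
open import Data.Sum using (inj₁; inj₂)
open import Data.List using (List; []; _∷_)
open import Function using (id)
open import Function.Bundles using (_⇔_; mk⇔; Equivalence)
open import Relation.Binary.PropositionalEquality using (refl; sym; subst)
open import Relation.Nullary using (¬_)

open Equivalence using (to; from)

data Exposed : Proc → Set where
  here : ∀ {α Q} → Unauthorized α → Exposed (α · Q)
  parˡ : ∀ {P Q} → Exposed P → Exposed (P ∣ Q)
  parʳ : ∀ {P Q} → Exposed Q → Exposed (P ∣ Q)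
  res  : ∀ {a P} → Exposed P → Exposed (ν a P)

exposed-νs : ∀ as {α Q R} → Unauthorized α → Exposed (νs as ((α · Q) ∣ R))
exposed-νs []       u = parˡ (here u)
exposed-νs (a ∷ as) u = res (exposed-νs as u)

-- Renaming channels does not affect unauthorization: it depends only on
-- the qualified roles of a prefix.
unauthorized-swap : ∀ a b α → Unauthorized α ⇔ Unauthorized (swapPre a b α)
unauthorized-swap a b α = mk⇔ (rename α) (unrename α)
  where
  rename : ∀ α → Unauthorized α → Unauthorized (swapPre a b α)
  rename _ (ua-recvCh c r l d)   = ua-recvCh _ r l _
  rename _ (ua-sendCh c r l d)   = ua-sendCh _ r l _
  rename _ (ua-recvRole c r l s) = ua-recvRole _ r l s
  rename _ (ua-sendAuth c r l s) = ua-sendAuth _ r l s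
  rename _ (ua-sendUn c σ l s)   = ua-sendUn _ σ l s

  unrename : ∀ α → Unauthorized (swapPre a b α) → Unauthorized α
  unrename (sendCh c (unauth r) l d)          _ = ua-sendCh c r l d
  unrename (recvCh c (unauth r) l d)          _ = ua-recvCh c r l d
  unrename (sendRole c ρ l (unauth s))        _ = ua-sendUn c ρ l s
  unrename (sendRole c (unauth r) l (auth s)) _ = ua-sendAuth c r l s
  unrename (recvRole c (unauth r) l s)        _ = ua-recvRole c r l s
  unrename (sendCh c (auth r) l d)          ()
  unrename (recvCh c (auth r) l d)          ()
  unrename (sendRole c (auth r) l (auth s)) ()
  unrename (recvRole c (auth r) l s)        ()

exposed-swap : ∀ a b P → Exposed P ⇔ Exposed (swap a b P)
exposed-swap a b P = mk⇔ (rename P) (unrename P)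
  where
  rename : ∀ P → Exposed P → Exposed (swap a b P)
  rename (α · _) (here u) = here (to (unauthorized-swap a b α) u)
  rename (P ∣ _) (parˡ e) = parˡ (rename P e)
  rename (_ ∣ Q) (parʳ e) = parʳ (rename Q e)
  rename (ν _ P) (res e)  = res (rename P e)

  unrename : ∀ P → Exposed (swap a b P) → Exposed P
  unrename (α · _) (here u) = here (from (unauthorized-swap a b α) u)
  unrename (P ∣ _) (parˡ e) = parˡ (unrename P e)
  unrename (_ ∣ Q) (parʳ e) = parʳ (unrename Q e)
  unrename (ν _ P) (res e)  = res (unrename P e)

exposed-≡ₛ : ∀ {P Q} → P ≡ₛ Q → Exposed P ⇔ Exposed Q
exposed-≡ₛ s-refl        = mk⇔ id id
exposed-≡ₛ (s-sym e)     = mk⇔ (from (exposed-≡ₛ e)) (to (exposed-≡ₛ e))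
exposed-≡ₛ (s-trans e f) =
  mk⇔ (λ x → to (exposed-≡ₛ f) (to (exposed-≡ₛ e) x))
      (λ x → from (exposed-≡ₛ e) (from (exposed-≡ₛ f) x))
exposed-≡ₛ (s-par e f)   = mk⇔ forward backward
  where
  forward : Exposed _ → Exposed _
  forward (parˡ x) = parˡ (to (exposed-≡ₛ e) x)
  forward (parʳ x) = parʳ (to (exposed-≡ₛ f) x)
  backward : Exposed _ → Exposed _
  backward (parˡ x) = parˡ (from (exposed-≡ₛ e) x)
  backward (parʳ x) = parʳ (from (exposed-≡ₛ f) x)
exposed-≡ₛ (s-res e) =
  mk⇔ (λ { (res x) → res (to (exposed-≡ₛ e) x) })
      (λ { (res x) → res (from (exposed-≡ₛ e) x) })
exposed-≡ₛ (s-pre _) = mk⇔ (λ { (here u) → here u }) (λ { (here u) → here u })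
exposed-≡ₛ (s-alphaν {a} {b} {P} _) =
  mk⇔ (λ { (res x) → res (to (exposed-swap a b P) x) })
      (λ { (res x) → res (from (exposed-swap a b P) x) })
exposed-≡ₛ (s-alphaIn _) =
  mk⇔ (λ { (here (ua-recvCh c r l _)) → here (ua-recvCh c r l _) })
      (λ { (here (ua-recvCh c r l _)) → here (ua-recvCh c r l _) })
exposed-≡ₛ s-parNil = mk⇔ (λ { (parˡ x) → x ; (parʳ ()) }) parˡ
exposed-≡ₛ s-parComm = mk⇔ commute commute
  where
  commute : ∀ {P Q} → Exposed (P ∣ Q) → Exposed (Q ∣ P)
  commute (parˡ x) = parʳ x
  commute (parʳ x) = parˡ x
exposed-≡ₛ s-parAssoc =
  mk⇔ (λ { (parˡ (parˡ x)) → parˡ x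
         ; (parˡ (parʳ x)) → parʳ (parˡ x)
         ; (parʳ x)        → parʳ (parʳ x) })
      (λ { (parˡ x)        → parˡ (parˡ x)
         ; (parʳ (parˡ x)) → parˡ (parʳ x)
         ; (parʳ (parʳ x)) → parʳ x })
exposed-≡ₛ s-resNil  = mk⇔ (λ { (res ()) }) (λ ())
exposed-≡ₛ s-resComm =
  mk⇔ (λ { (res (res x)) → res (res x) }) (λ { (res (res x)) → res (res x) })
exposed-≡ₛ (s-extr _) =
  mk⇔ (λ { (parˡ (res x)) → res (parˡ x) ; (parʳ x) → res (parʳ x) })
      (λ { (res (parˡ x)) → parˡ (res x) ; (res (parʳ x)) → parʳ x })

_∈ᵘ_ : Chan × Role → USet → Set
(a , r) ∈ᵘ Σ = T (Σ a r)

∈-∪ˡ : ∀ {p} Σ Ξ → p ∈ᵘ Σ → p ∈ᵘ (Σ ∪ Ξ)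
∈-∪ˡ {a , r} Σ Ξ h = from (T-∨ {Σ a r} {Ξ a r}) (inj₁ h)

∈-∪ʳ : ∀ {p} Σ Ξ → p ∈ᵘ Ξ → p ∈ᵘ (Σ ∪ Ξ)
∈-∪ʳ {a , r} Σ Ξ h = from (T-∨ {Σ a r} {Ξ a r}) (inj₂ h)

∈-single : ∀ a r → (a , r) ∈ᵘ single a r
∈-single a r = from T-∧ (≡⇒≡ᵇ a a refl , ≡⇒≡ᵇ r r refl)

∈-≈ : ∀ {p Σ Σ'} → Σ' ≈ Σ → p ∈ᵘ Σ → p ∈ᵘ Σ'
∈-≈ {a , r} eq = subst T (sym (eq a r))

∈-ua : ∀ {Σ Σ'} a r → Σ' ≈ Σ ∪ ua a (unauth r) → (a , r) ∈ᵘ Σ'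
∈-ua {Σ} a r eq = ∈-≈ eq (∈-∪ʳ Σ (single a r) (∈-single a r))

exposed⇒recorded : ∀ {Δ Γ Σ P} → Δ ⨾ Γ ⊢[ Σ ] P → Exposed P → ∃[ p ] p ∈ᵘ Σ
exposed⇒recorded (t-nil _ _) ()
exposed⇒recorded (t-resS _ d)     (res x) = exposed⇒recorded d x
exposed⇒recorded (t-resL _ d _ _) (res x) = exposed⇒recorded d x
exposed⇒recorded (t-par {Σ = Σ} {Ξ = Ξ} _ d _ eq) (parˡ x) with exposed⇒recorded d x
... | p , h = p , ∈-≈ eq (∈-∪ˡ Σ Ξ h)
exposed⇒recorded (t-par {Σ = Σ} {Ξ = Ξ} _ _ d eq) (parʳ x) with exposed⇒recorded d x
... | p , h = p , ∈-≈ eq (∈-∪ʳ Σ Ξ h)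
exposed⇒recorded (t-recvRole _ _ _ _ _ eq) (here (ua-recvRole a r _ _)) = (a , r) , ∈-ua a r eq
exposed⇒recorded (t-recvChL _ _ _ _ _ _ eq) (here (ua-recvCh a r _ _))  = (a , r) , ∈-ua a r eq
exposed⇒recorded (t-recvChS _ _ _ _ _ _ eq) (here (ua-recvCh a r _ _))  = (a , r) , ∈-ua a r eq
exposed⇒recorded (t-sendChL _ _ _ _ _ eq)   (here (ua-sendCh a r _ _))  = (a , r) , ∈-ua a r eq
exposed⇒recorded (t-sendChS _ _ _ _ _ eq)   (here (ua-sendCh a r _ _))  = (a , r) , ∈-ua a r eq
exposed⇒recorded (t-sendRole {Σ = Σ} _ _ _ _ eq) (here (ua-sendAuth a r _ _)) =
  (a , r) , ∈-≈ eq (∈-∪ˡ (Σ ∪ single a r) ∅ (∈-∪ʳ Σ (single a r) (∈-single a r)))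
exposed⇒recorded (t-sendRole {Σ = Σ} {ρ = ρ} _ _ _ _ eq) (here (ua-sendUn a _ _ s)) =
  (a , s) , ∈-≈ eq (∈-∪ʳ (Σ ∪ ua a ρ) (single a s) (∈-single a s))
exposed⇒recorded (t-accept _ _ _ _) (here ())
exposed⇒recorded (t-request _ _ _)  (here ())

mainTheorem1 : (P : Proc) →
    (∃[ Δ ] ∃[ Γ ] (Δ ⨾ Γ ⊢[ ∅ ] P)) → ¬ AuthError P
mainTheorem1 P (Δ , Γ , typed) (as , α , Q , R , unauthorized , P≡ₛerror)
  with exposed⇒recorded typed
         (from (exposed-≡ₛ P≡ₛerror) (exposed-νs as unauthorized))
... | _ , ()
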